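{- Let $M$ be a locally bounded commutative ordered monoid with distinguished element $0$, with $0\leq1$, whose multiplication is continuous, preadmissible, and satisfies condition (*) relative to $\overline{M}$ (defined in the context). Equip the completion $\overline{M}$ with the multiplication $xy=\sup P_{x,y}$. Then for each $x\in\overline{M}$, $x0=0=0x$.
   Context: All reasoning is constructive (no law of excluded middle). An ordered set is a set $X$ with a binary relation $<$ satisfying, for all $x,y,z$: asymmetry ($x<y$ implies not $y<x$), cotransitivity ($x<y$ implies $x<z$ or $z<y$), and negative antisymmetry (not $x<y$ and not $y<x$ imply $x=y$). Write $x\leq y$ for "not $y<x$", $x>y$ for $y<x$. A subset $S$ of $X$ is almost dense if $x<y$ in $X$ implies $x\leq s<s'\leq y$ for some $s,s'\in S$; bicofinal if each $x\in X$ satisfies $s\leq x\leq s'$ for some $s,s'\in S$; upper order located if $x<y$ implies either $x<s$ for some $s\in S$ or $u<y$ for some upper bound $u$ of $S$; supable if nonempty, bounded above and upper order located. $X$ is complete if every supable subset has a supremum in $X$. A completion of $X$ is a complete ordered set $Y$ with an order embedding ($x<x'$ iff $f(x)<f(x')$) $f:X\to Y$ whose image is almost dense and bicofinal in $Y$; it exists and is unique up to isomorphism, and $\overline{M}$ denotes the completion of $M$, with $M$ identified with its image. A set is finitely enumerable if it is empty or the image of $\{1,\dots,n\}$. A commutative ordered monoid with distinguished element $0$ is an ordered set $M$ with a distinguished element $0$ and a commutative monoid multiplication (identity $1$) such that $0<x,0<y$ imply $0<xy$; it is locally bounded if every finitely enumerable subset has a minimum and a maximum. The multiplication on $M$ is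 preadmissible if $0x=0=x0$, $x<y$ and $z>0$ imply $xz<yz$, and $x<y$ and $z<0$ imply $xz>yz$. Continuity refers to the order topology on $M$ (generated by open intervals $\{z:a<z<b\}$) and the product topology on $M\times M$. Condition (*): for all $x,y\in\overline{M}$, if $c<d$ in $M$ then there are $a,b,a',b'\in M$ with $a\leq x\leq b$, $a'\leq y\leq b'$ and either $c<\min\{aa',ab',ba',bb'\}$ or $\max\{aa',ab',ba',bb'\}<d$ (min, max in $M$). For $x,y\in\overline{M}$, $P_{x,y}=\{\min\{aa',ab',ba',bb'\}: a,b,a',b'\in M,\ a\leq x\leq b,\ a'\leq y\leq b'\}$; under these hypotheses $P_{x,y}$ is supable, so $xy:=\sup P_{x,y}$ exists in $\overline{M}$. -}

module Defs where

open import Data.Nat using (ℕ; suc)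
open import Data.Fin using (Fin)
open import Data.Product using (Σ; ∃; _×_; _,_)
open import Data.Sum using (_⊎_)
open import Data.List using (List)
open import Data.List.Relation.Unary.All using (All)
open import Relation.Nullary using (¬_)
open import Relation.Binary.PropositionalEquality using (_≡_)

record IsOrdered {X : Set} (_<_ : X → X → Set) : Set where
  field
    asym       : ∀ {x y} → x < y → ¬ (y < x)
    cotrans    : ∀ {x y} → x < y → ∀ z → (x < z) ⊎ (z < y)
    negAntisym : ∀ {x y} → ¬ (x < y) → ¬ (y < x) → x ≡ y

module OrderNotions {X : Set} (_<_ : X → X → Set) where

  _≤_ : X → X → Set
  x ≤ y = ¬ (y < x)

  IsUpperBound : (X → Set) → X → Set
  IsUpperBound S u = ∀ s → S s → s ≤ u

  BoundedAbove : (X → Set) → Set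
  BoundedAbove S = ∃ λ u → IsUpperBound S u

  Inhabited : (X → Set) → Set
  Inhabited S = ∃ λ s → S s

  UpperOrderLocated : (X → Set) → Set
  UpperOrderLocated S = ∀ x y → x < y →
    (∃ λ s → S s × x < s) ⊎ (∃ λ u → IsUpperBound S u × u < y)

  Supable : (X → Set) → Set
  Supable S = Inhabited S × BoundedAbove S × UpperOrderLocated S

  IsSup : (X → Set) → X → Set
  IsSup S s = IsUpperBound S s × (∀ y → y < s → ∃ λ t → S t × y < t)

  Complete : Set₁
  Complete = ∀ (S : X → Set) → Supable S → ∃ λ s → IsSup S s

  AlmostDense : (X → Set) → Set
  AlmostDense S = ∀ x y → x < y →
    Σ X λ s → Σ X λ s' → S s × S s' × x ≤ s × s < s' × s' ≤ y

  Bicofinal : (X → Set) → Set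
  Bicofinal S = ∀ x → Σ X λ s → Σ X λ s' → S s × S s' × s ≤ x × x ≤ s'

  IsMinimum : (X → Set) → X → Set
  IsMinimum S m = S m × (∀ s → S s → m ≤ s)

  IsMaximum : (X → Set) → X → Set
  IsMaximum S m = S m × (∀ s → S s → s ≤ m)

  Four : X → X → X → X → X → Set
  Four p q r t z = (z ≡ p) ⊎ (z ≡ q) ⊎ (z ≡ r) ⊎ (z ≡ t)

Image : {A B : Set} → (A → B) → B → Set
Image f y = ∃ λ a → f a ≡ y

record OrdMonoid0 : Set₁ where
  infixl 7 _·_
  infix 4 _<_
  field
    Carrier   : Set
    _<_       : Carrier → Carrier → Set
    isOrdered : IsOrdered _<_
    _·_       : Carrier → Carrier → Carrier
    one       : Carrier
    zero      : Carrier
    assoc     : ∀ x y z → (x · y) · z ≡ x · (y · z)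
    comm      : ∀ x y → x · y ≡ y · x
    identityˡ : ∀ x → one · x ≡ x
    identityʳ : ∀ x → x · one ≡ x
    pos·pos   : ∀ {x y} → zero < x → zero < y → zero < x · y

module _ (M : OrdMonoid0) where
  open OrdMonoid0 M
  open OrderNotions _<_

  -- every inhabited finitely enumerable subset has a minimum and a maximum
  LocallyBounded : Set
  LocallyBounded = ∀ (n : ℕ) (g : Fin (suc n) → Carrier) →
    (∃ λ m → IsMinimum (Image g) m) × (∃ λ m → IsMaximum (Image g) m)

  Preadmissible : Set
  Preadmissible =
    (∀ x → (zero · x ≡ zero) × (x · zero ≡ zero)) ×
    (∀ x y z → x < y → zero < z → (x · z) < (y · z)) ×
    (∀ x y z → x < y → z < zero → (y · z) < (x · z))

  -- neighbourhood given by a finite intersection of open intervals (a,b)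
  InIntervals : List (Carrier × Carrier) → Carrier → Set
  InIntervals L z = All (λ ab → (Data.Product.proj₁ ab < z) × (z < Data.Product.proj₂ ab)) L

  -- continuity of · : M × M → M, order topology generated by open
  -- intervals, product topology on M × M (checked on subbasic opens)
  Continuous : Set
  Continuous = ∀ a b x y → a < x · y → x · y < b →
    Σ (List (Carrier × Carrier)) λ Lx → Σ (List (Carrier × Carrier)) λ Ly →
      InIntervals Lx x × InIntervals Ly y ×
      (∀ u v → InIntervals Lx u → InIntervals Ly v → (a < u · v) × (u · v < b))

  record IsCompletion (Y : Set) (_<Y_ : Y → Y → Set) (f : Carrier → Y) : Set₁ where
    field
      isOrderedY  : IsOrdered _<Y_
      embed       : ∀ x x' → x < x' → f x <Y f x'
      reflect     : ∀ x x' → f x <Y f x' → x < x'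
      almostDense : OrderNotions.AlmostDense _<Y_ (Image f)
      bicofinal   : OrderNotions.Bicofinal _<Y_ (Image f)
      complete    : OrderNotions.Complete _<Y_

  module _ (Y : Set) (_<Y_ : Y → Y → Set) (f : Carrier → Y) where
    private
      _≤Y_ : Y → Y → Set
      _≤Y_ = OrderNotions._≤_ _<Y_

    Brackets : Y → Y → Carrier → Carrier → Carrier → Carrier → Set
    Brackets x y a b a' b' =
      (f a ≤Y x) × (x ≤Y f b) × (f a' ≤Y y) × (y ≤Y f b')

    ConditionStar : Set
    ConditionStar = ∀ (x y : Y) (c d : Carrier) → c < d →
      Σ Carrier λ a → Σ Carrier λ b → Σ Carrier λ a' → Σ Carrier λ b' →
        Brackets x y a b a' b' ×
        ((∃ λ m → IsMinimum (Four (a · a') (a · b') (b · a') (b · b')) m × c < m)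
         ⊎ (∃ λ m → IsMaximum (Four (a · a') (a · b') (b · a') (b · b')) m × m < d))

    P : Y → Y → Y → Set
    P x y t = Σ Carrier λ a → Σ Carrier λ b → Σ Carrier λ a' → Σ Carrier λ b' →
      Brackets x y a b a' b' ×
      (∃ λ m → IsMinimum (Four (a · a') (a · b') (b · a') (b · b')) m × (f m ≡ t))

-- The supremum defining x·0 is attained at 0 itself.  Taking a' = b' = 0, every
-- product in the min vanishes, so 0 ∈ P_{x,0}.  Conversely, if t ∈ P_{x,0} with
-- 0 < t then a·a' and a·b' are both positive although a' ≤ 0 ≤ b', and a sign
-- argument with preadmissibility rules this out, so 0 is an upper bound.
module Submission where

open import Defs
open import Data.Empty using (⊥; ⊥-elim)
open import Data.Product using (∃; _×_; _,_; proj₁; proj₂)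
open import Data.Sum using (inj₁; inj₂)
open import Relation.Nullary using (¬_)
open import Relation.Binary.PropositionalEquality using (_≡_; _≢_; refl; sym; trans; subst; subst₂)

module OrderedProperties {X : Set} {_<_ : X → X → Set} (ord : IsOrdered _<_) where
  open IsOrdered ord
  open OrderNotions _<_

  <-irrefl : ∀ {x} → ¬ (x < x)
  <-irrefl x<x = asym x<x x<x

  ≤-refl : ∀ {x} → x ≤ x
  ≤-refl = <-irrefl

  ≡⇒≤ : ∀ {x y} → x ≡ y → x ≤ y
  ≡⇒≤ refl = ≤-refl

  <-≤-trans : ∀ {x y z} → x < y → y ≤ z → x < z
  <-≤-trans {z = z} x<y y≤z with cotrans x<y z
  ... | inj₁ x<z = x<z
  ... | inj₂ z<y = ⊥-elim (y≤z z<y)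

  Four-≡ : ∀ {p q r t m s} → p ≡ m → q ≡ m → r ≡ m → t ≡ m → Four p q r t s → s ≡ m
  Four-≡ p≡m _ _ _ (inj₁ s≡p)               = trans s≡p p≡m
  Four-≡ _ q≡m _ _ (inj₂ (inj₁ s≡q))        = trans s≡q q≡m
  Four-≡ _ _ r≡m _ (inj₂ (inj₂ (inj₁ s≡r))) = trans s≡r r≡m
  Four-≡ _ _ _ t≡m (inj₂ (inj₂ (inj₂ s≡t))) = trans s≡t t≡m

  Four-≡-min : ∀ {p q r t m} → p ≡ m → q ≡ m → r ≡ m → t ≡ m → IsMinimum (Four p q r t) m
  Four-≡-min p≡m q≡m r≡m t≡m =
    inj₁ (sym p≡m) , λ s s∈ → ≡⇒≤ (sym (Four-≡ p≡m q≡m r≡m t≡m s∈))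

  max⇒sup : ∀ {S s} → S s → IsUpperBound S s → IsSup S s
  max⇒sup s∈S s-ub = s-ub , λ y y<s → _ , s∈S , y<s

module PreadmissibleProperties (M : OrdMonoid0) (pre : Preadmissible M) where
  open OrdMonoid0 M
  open IsOrdered isOrdered
  open OrderNotions _<_
  open OrderedProperties isOrdered

  ·-zeroˡ : ∀ x → zero · x ≡ zero
  ·-zeroˡ x = proj₁ (proj₁ pre x)

  ·-zeroʳ : ∀ x → x · zero ≡ zero
  ·-zeroʳ x = proj₂ (proj₁ pre x)

  ·-monoˡ-<-pos : ∀ {x y z} → x < y → zero < z → x · z < y · z
  ·-monoˡ-<-pos {x} {y} {z} = proj₁ (proj₂ pre) x y z

  ·-pos⇒≢zeroˡ : ∀ {c p} → zero < c · p → c ≢ zero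
  ·-pos⇒≢zeroˡ {p = p} 0<cp refl = <-irrefl (subst (zero <_) (·-zeroˡ p) 0<cp)

  ·-pos⇒≢zeroʳ : ∀ {c p} → zero < c · p → p ≢ zero
  ·-pos⇒≢zeroʳ {c} 0<cp refl = <-irrefl (subst (zero <_) (·-zeroʳ c) 0<cp)

  -- c cannot be positive (c·p < 0) nor negative (c·q < 0), hence c = 0.
  ·-pos-opposite-signs : ∀ {c p q} → p < zero → zero < q →
    zero < c · p → zero < c · q → ⊥
  ·-pos-opposite-signs {c} {p} {q} p<0 0<q 0<cp 0<cq =
    ·-pos⇒≢zeroˡ 0<cp (negAntisym ¬c<0 ¬0<c)
    where
    ¬c<0 : ¬ (c < zero)
    ¬c<0 c<0 = asym 0<cq (subst (c · q <_) (·-zeroˡ q) (·-monoˡ-<-pos c<0 0<q))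

    ¬0<c : ¬ (zero < c)
    ¬0<c 0<c = asym 0<cp (subst₂ _<_ (comm p c) (·-zeroˡ c) (·-monoˡ-<-pos p<0 0<c))

  ·-pos-across-zero : ∀ {c p q} → p ≤ zero → zero ≤ q →
    zero < c · p → zero < c · q → ⊥
  ·-pos-across-zero {c} {p} {q} p≤0 0≤q 0<cp 0<cq =
    ·-pos⇒≢zeroʳ 0<cp (negAntisym ¬p<0 p≤0)
    where
    ¬p<0 : ¬ (p < zero)
    ¬p<0 p<0 = ·-pos⇒≢zeroʳ 0<cq
      (sym (negAntisym (λ 0<q → ·-pos-opposite-signs p<0 0<q 0<cp 0<cq) 0≤q))

module CompletionProduct (M : OrdMonoid0) (pre : Preadmissible M)
  (Y : Set) (_<Y_ : Y → Y → Set) (f : OrdMonoid0.Carrier M → Y)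
  (C : IsCompletion M Y _<Y_ f) where
  open OrdMonoid0 M
  open IsCompletion C
  open OrderNotions _<_ using (_≤_)
  open OrderNotions _<Y_ using () renaming (_≤_ to _≤Y_)
  open OrderedProperties isOrdered using (<-≤-trans; Four-≡-min)
  open OrderedProperties isOrderedY using () renaming (≤-refl to ≤Y-refl)
  open PreadmissibleProperties M pre

  Pᴹ : Y → Y → Y → Set
  Pᴹ = P M Y _<Y_ f

  ≤-reflect : ∀ {a b} → f a ≤Y f b → a ≤ b
  ≤-reflect fa≤fb b<a = fa≤fb (embed _ _ b<a)

  bracket : ∀ x → ∃ λ a → ∃ λ b → f a ≤Y x × x ≤Y f b
  bracket x with bicofinal x
  ... | _ , _ , (a , refl) , (b , refl) , fa≤x , x≤fb = a , b , fa≤x , x≤fb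

  zero∈P-zeroʳ : ∀ x → Pᴹ x (f zero) (f zero)
  zero∈P-zeroʳ x with bracket x
  ... | a , b , fa≤x , x≤fb =
    a , b , zero , zero , (fa≤x , x≤fb , ≤Y-refl , ≤Y-refl) , zero ,
    Four-≡-min (·-zeroʳ a) (·-zeroʳ a) (·-zeroʳ b) (·-zeroʳ b) , refl

  zero∈P-zeroˡ : ∀ x → Pᴹ (f zero) x (f zero)
  zero∈P-zeroˡ x with bracket x
  ... | a , b , fa≤x , x≤fb =
    zero , zero , a , b , (≤Y-refl , ≤Y-refl , fa≤x , x≤fb) , zero ,
    Four-≡-min (·-zeroˡ a) (·-zeroˡ b) (·-zeroˡ a) (·-zeroˡ b) , refl

  P-zeroʳ-≤ : ∀ x t → Pᴹ x (f zero) t → t ≤Y f zero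
  P-zeroʳ-≤ x t (_ , _ , _ , _ , (_ , _ , fa′≤f0 , f0≤fb′) , m , (_ , m-min) , fm≡t) f0<t =
    ·-pos-across-zero (≤-reflect fa′≤f0) (≤-reflect f0≤fb′)
      (<-≤-trans 0<m (m-min _ (inj₁ refl)))
      (<-≤-trans 0<m (m-min _ (inj₂ (inj₁ refl))))
    where
    0<m : zero < m
    0<m = reflect zero m (subst (f zero <Y_) (sym fm≡t) f0<t)

  P-zeroˡ-≤ : ∀ x t → Pᴹ (f zero) x t → t ≤Y f zero
  P-zeroˡ-≤ x t (a , b , a′ , _ , (fa≤f0 , f0≤fb , _ , _) , m , (_ , m-min) , fm≡t) f0<t =
    ·-pos-across-zero (≤-reflect fa≤f0) (≤-reflect f0≤fb)
      (subst (zero <_) (comm a a′) (<-≤-trans 0<m (m-min _ (inj₁ refl))))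
      (subst (zero <_) (comm b a′) (<-≤-trans 0<m (m-min _ (inj₂ (inj₂ (inj₁ refl))))))
    where
    0<m : zero < m
    0<m = reflect zero m (subst (f zero <Y_) (sym fm≡t) f0<t)

theorem14 : (M : OrdMonoid0) → LocallyBounded M →
    ¬ (OrdMonoid0._<_ M (OrdMonoid0.one M) (OrdMonoid0.zero M)) →
    Continuous M → Preadmissible M →
    (Y : Set) (_<Y_ : Y → Y → Set) (f : OrdMonoid0.Carrier M → Y) →
    IsCompletion M Y _<Y_ f → ConditionStar M Y _<Y_ f →
    (x : Y) →
      OrderNotions.IsSup _<Y_ (P M Y _<Y_ f x (f (OrdMonoid0.zero M))) (f (OrdMonoid0.zero M)) ×
      OrderNotions.IsSup _<Y_ (P M Y _<Y_ f (f (OrdMonoid0.zero M)) x) (f (OrdMonoid0.zero M))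
theorem14 M _ _ _ pre Y _<Y_ f C _ x =
  max⇒sup (zero∈P-zeroʳ x) (P-zeroʳ-≤ x) , max⇒sup (zero∈P-zeroˡ x) (P-zeroˡ-≤ x)
  where
  open CompletionProduct M pre Y _<Y_ f C
  open OrderedProperties (IsCompletion.isOrderedY C) using (max⇒sup)
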